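{- Let $A$ be an $n\times n$ lower triangular matrix over the field $\mathrm{GF}(2)$ with $a_{ii}=1$ for $i=1,\ldots,n$, and let $B=A^{ -1}$. Then for $1\le j\le i\le n$, $b_{ij}=1$ if and only if the number of alternating paths from $C_i$ to $R_j$ in $G(A)$ (with respect to the matching $\mathcal{M}=\{R_1C_1,\ldots,R_nC_n\}$) is odd.
   Context: $G(A)$ is the bipartite graph with vertex set $\{R_1,\ldots,R_n\}\cup\{C_1,\ldots,C_n\}$ and an edge between $R_i$ and $C_j$ if and only if $a_{ij}\neq 0$. With respect to the matching $\mathcal{M}$, a path is alternating if its edges are alternately in $\mathcal{M}$ and not in $\mathcal{M}$, with the first and last edges in $\mathcal{M}$ (a single edge of $\mathcal{M}$ is an alternating path). -}

module Defs where

open import Data.Bool using (Bool; true; false; _xor_; _∧_)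
open import Data.Nat using (ℕ; zero; suc; _<_)
open import Data.Fin using (Fin; toℕ; _≟_)
open import Data.List using (List; []; _∷_; foldr; map; concatMap; filter; length; head; last)
open import Data.List.Relation.Unary.Linked using (Linked; linked?)
open import Data.List.Relation.Unary.Unique.Propositional using (Unique)
import Data.List.Relation.Unary.Unique.DecPropositional as UDec
open import Data.Maybe using (Maybe; just)
import Data.Maybe.Properties as MaybeP
open import Data.Fin.Base using (Fin)
open import Data.List using (allFin)
open import Data.Product using (_×_)
open import Relation.Binary.PropositionalEquality using (_≡_)
open import Relation.Nullary using (Dec; yes; no)
open import Relation.Nullary.Decidable using (_×-dec_)
open import Data.Bool.Properties using () renaming (_≟_ to _≟ᵇ_)

-- GF(2) is modelled by Bool: addition = xor, multiplication = ∧.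
-- An n×n matrix over GF(2).
Matrix : ℕ → Set
Matrix n = Fin n → Fin n → Bool

Σ₂ : ∀ {n} → (Fin n → Bool) → Bool
Σ₂ {n} f = foldr (λ k acc → f k xor acc) false (allFin n)

_⊗_ : ∀ {n} → Matrix n → Matrix n → Matrix n
(A ⊗ B) i j = Σ₂ (λ k → A i k ∧ B k j)

identity : ∀ {n} → Matrix n
identity i j with i ≟ j
... | yes _ = true
... | no  _ = false

LowerTriangular : ∀ {n} → Matrix n → Set
LowerTriangular {n} A = ∀ (i j : Fin n) → toℕ i < toℕ j → A i j ≡ false

UnitDiagonal : ∀ {n} → Matrix n → Set
UnitDiagonal {n} A = ∀ (i : Fin n) → A i i ≡ true

IsInverse : ∀ {n} → Matrix n → Matrix n → Set
IsInverse {n} A B = (∀ (i j : Fin n) → (A ⊗ B) i j ≡ identity i j)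
                  × (∀ (i j : Fin n) → (B ⊗ A) i j ≡ identity i j)

-- G(A): edge R_k — C_l iff a_kl ≠ 0, i.e. A k l ≡ true.
Edge : ∀ {n} → Matrix n → Fin n → Fin n → Set
Edge A k l = A k l ≡ true

-- An alternating path (w.r.t. M = {R_1C_1,…,R_nC_n}) from C_i to R_j is
--   C_{k0} R_{k0} C_{k1} R_{k1} … C_{km} R_{km}
-- with k0 = i, km = j, edges R_{k_t} C_{k_{t+1}} of G(A) (non-matching since
-- k_t ≠ k_{t+1}) and all vertices distinct (i.e. the k_t distinct).
-- It is determined by the list k0 ∷ … ∷ km of indices.
AltPath : ∀ {n} → Matrix n → Fin n → Fin n → List (Fin n) → Set
AltPath A i j ks =
  (head ks ≡ just i) × (last ks ≡ just j) × Unique ks × Linked (Edge A) ks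

altPath? : ∀ {n} (A : Matrix n) (i j : Fin n) (ks : List (Fin n)) → Dec (AltPath A i j ks)
altPath? A i j ks =
  MaybeP.≡-dec _≟_ (head ks) (just i) ×-dec
  (MaybeP.≡-dec _≟_ (last ks) (just j) ×-dec
  (UDec.unique? _≟_ ks ×-dec
  linked? (λ k l → A k l ≟ᵇ true) ks))

listsUpTo : ∀ {n} → ℕ → List (List (Fin n))
listsUpTo zero    = [] ∷ []
listsUpTo {n} (suc m) = [] ∷ concatMap (λ k → map (k ∷_) (listsUpTo m)) (allFin n)

-- Number of alternating paths from C_i to R_j in G(A).
-- A path has distinct vertices, so its index list has length ≤ n and
-- is enumerated exactly once by listsUpTo n.
numAltPaths : ∀ {n} → Matrix n → Fin n → Fin n → ℕ
numAltPaths {n} A i j = length (filter (altPath? A i j) (listsUpTo {n} n))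

module Submission where

-- Work over GF(2) = (Bool, xor, ∧) and write δ_ij for the
-- identity matrix.  Row i of A·B = I together with a_ii = 1 gives
--   b_ij = δ_ij + Σ_{k ≠ i} a_ik b_kj.                                (R)
-- On the graph side, an alternating path C_i R_i … C_j R_j is either the
-- single matching edge (when i = j) or a non-matching edge R_i C_k with
-- k ≠ i followed by an alternating path from C_k to R_j.  Because A is
-- lower triangular every such edge has k < i, so index lists of paths
-- strictly decrease and distinctness of their vertices is automatic.
-- Hence the parity Q_m(i,j) of the paths with at most m+1 matching edges
-- satisfies Q_0 = δ and Q_{m+1}(i,j) = δ_ij + Σ_{k ≠ i} a_ik Q_m(k,j), and
-- comparing with (R) by induction on m gives Q_m(i,j) = b_ij when i ≤ m.

open import Defs
open import Data.Bool using (true)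
open import Data.Nat using (ℕ; _≤_; _%_)
open import Data.Fin using (Fin; toℕ)
open import Function.Bundles using (_⇔_)
open import Relation.Binary.PropositionalEquality using (_≡_)

open import Algebra.Bundles using (CommutativeRing)
open import Algebra.Properties.CommutativeSemigroup using (interchange)
open import Data.Bool using (Bool; false; not; _xor_; _∧_)
open import Data.Bool.Properties
  using (xor-assoc; xor-identityʳ; xor-same; ∧-zeroʳ; not-involutive; xor-∧-commutativeRing)
open import Data.Fin using (zero; suc; _≟_)
open import Data.Fin.Properties using (toℕ-injective; toℕ<n; suc-injective)
open import Data.List using (List; []; _∷_; foldr; map; concatMap; filter; length; _++_; tabulate; allFin)
open import Data.List.Properties using (map-tabulate)
open import Data.List.Relation.Unary.All as All using (All; []; _∷_)
open import Data.List.Relation.Unary.AllPairs using ([]; _∷_)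
open import Data.List.Relation.Unary.Linked using (Linked; [-]; _∷_)
open import Data.List.Relation.Unary.Unique.Propositional using (Unique)
open import Data.Maybe using (just)
open import Data.Maybe.Properties using (just-injective)
open import Data.Nat using (suc; _<_; _≮_)
open import Data.Nat.Properties using (≤-refl; ≤-trans; <⇒≤; <⇒≱; ≤∧≢⇒<; ≮⇒≥; ≤-pred; <-≤-trans; n≮0)
open import Data.Product using (_,_)
open import Data.Empty using (⊥-elim)
open import Function using (_∘_)
open import Function.Bundles using (mk⇔)
open import Relation.Nullary using (Dec; yes; no; does; ¬_)
open import Relation.Nullary.Decidable using (dec-true; dec-false; does-≡; map′)
open import Relation.Unary using (Decidable)
open import Relation.Binary.PropositionalEquality using (refl; sym; trans; cong; cong₂; subst; _≢_; module ≡-Reasoning)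

open ≡-Reasoning

sum₂ : ∀ {X : Set} → List X → (X → Bool) → Bool
sum₂ L p = foldr (λ x acc → p x xor acc) false L

sum₂-cong : ∀ {X : Set} (L : List X) {p q : X → Bool} → (∀ x → p x ≡ q x) → sum₂ L p ≡ sum₂ L q
sum₂-cong []      p≡q = refl
sum₂-cong (x ∷ L) p≡q = cong₂ _xor_ (p≡q x) (sum₂-cong L p≡q)

sum₂-zero : ∀ {X : Set} (L : List X) {p : X → Bool} → (∀ x → p x ≡ false) → sum₂ L p ≡ false
sum₂-zero []      p≡0 = refl
sum₂-zero (x ∷ L) p≡0 rewrite p≡0 x = sum₂-zero L p≡0

sum₂-∧ : ∀ {X : Set} (L : List X) (c : Bool) (p : X → Bool) → sum₂ L (λ x → c ∧ p x) ≡ c ∧ sum₂ L p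
sum₂-∧ L true  p = refl
sum₂-∧ L false p = sum₂-zero L (λ _ → refl)

sum₂-xor : ∀ {X : Set} (L : List X) (p q : X → Bool) → sum₂ L (λ x → p x xor q x) ≡ sum₂ L p xor sum₂ L q
sum₂-xor []      p q = refl
sum₂-xor (x ∷ L) p q rewrite sum₂-xor L p q =
  interchange (CommutativeRing.+-commutativeSemigroup xor-∧-commutativeRing) (p x) (q x) (sum₂ L p) (sum₂ L q)

sum₂-++ : ∀ {X : Set} (L M : List X) (p : X → Bool) → sum₂ (L ++ M) p ≡ sum₂ L p xor sum₂ M p
sum₂-++ []      M p = refl
sum₂-++ (x ∷ L) M p rewrite sum₂-++ L M p = sym (xor-assoc (p x) (sum₂ L p) (sum₂ M p))

sum₂-map : ∀ {X Y : Set} (g : X → Y) (L : List X) (p : Y → Bool) → sum₂ (map g L) p ≡ sum₂ L (p ∘ g)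
sum₂-map g []      p = refl
sum₂-map g (x ∷ L) p = cong (p (g x) xor_) (sum₂-map g L p)

sum₂-concatMap : ∀ {X Y : Set} (f : X → List Y) (L : List X) (p : Y → Bool) →
  sum₂ (concatMap f L) p ≡ sum₂ L (λ x → sum₂ (f x) p)
sum₂-concatMap f []      p = refl
sum₂-concatMap f (x ∷ L) p =
  trans (sum₂-++ (f x) (concatMap f L) p) (cong (sum₂ (f x) p xor_) (sum₂-concatMap f L p))

Σ₂-suc : ∀ {n} (f : Fin (suc n) → Bool) → Σ₂ f ≡ f zero xor Σ₂ (f ∘ suc)
Σ₂-suc {n} f = cong (f zero xor_) (begin
  sum₂ (tabulate suc) f           ≡⟨ cong (λ L → sum₂ L f) (sym (map-tabulate (λ k → k) suc)) ⟩
  sum₂ (map suc (allFin n)) f     ≡⟨ sum₂-map suc (allFin n) f ⟩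
  Σ₂ (f ∘ suc)                    ∎)

Σ₂-single : ∀ {n} (f : Fin n → Bool) (i : Fin n) → (∀ k → k ≢ i → f k ≡ false) → Σ₂ f ≡ f i
Σ₂-single {suc n} f zero    off = begin
  Σ₂ f                    ≡⟨ Σ₂-suc f ⟩
  f zero xor Σ₂ (f ∘ suc) ≡⟨ cong (f zero xor_) (sum₂-zero (allFin n) (λ k → off (suc k) (λ ()))) ⟩
  f zero xor false        ≡⟨ xor-identityʳ (f zero) ⟩
  f zero                  ∎
Σ₂-single {suc n} f (suc i) off = begin
  Σ₂ f                    ≡⟨ Σ₂-suc f ⟩
  f zero xor Σ₂ (f ∘ suc) ≡⟨ cong (_xor Σ₂ (f ∘ suc)) (off zero (λ ())) ⟩
  Σ₂ (f ∘ suc)            ≡⟨ Σ₂-single (f ∘ suc) i (λ k k≢i → off (suc k) (k≢i ∘ suc-injective)) ⟩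
  f (suc i)               ∎

Σ₂≢ : ∀ {n} → Fin n → (Fin n → Bool) → Bool
Σ₂≢ i f = Σ₂ (λ k → not (does (k ≟ i)) ∧ f k)

Σ₂-split : ∀ {n} (f : Fin n → Bool) (i : Fin n) → Σ₂ f ≡ f i xor Σ₂≢ i f
Σ₂-split {n} f i = begin
  Σ₂ f                                                ≡⟨ sum₂-cong (allFin n) (λ k → case-split (does (k ≟ i)) (f k)) ⟩
  Σ₂ (λ k → (does (k ≟ i) ∧ f k) xor (not (does (k ≟ i)) ∧ f k))
                                                      ≡⟨ sum₂-xor (allFin n) (λ k → does (k ≟ i) ∧ f k) (λ k → not (does (k ≟ i)) ∧ f k) ⟩
  Σ₂ (λ k → does (k ≟ i) ∧ f k) xor Σ₂≢ i f           ≡⟨ cong (_xor Σ₂≢ i f) (Σ₂-single _ i off-i) ⟩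
  (does (i ≟ i) ∧ f i) xor Σ₂≢ i f                    ≡⟨ cong (λ b → (b ∧ f i) xor Σ₂≢ i f) (dec-true (i ≟ i) refl) ⟩
  f i xor Σ₂≢ i f                                     ∎
  where
  case-split : ∀ b x → x ≡ (b ∧ x) xor (not b ∧ x)
  case-split true  x = sym (xor-identityʳ x)
  case-split false x = refl
  off-i : ∀ k → k ≢ i → does (k ≟ i) ∧ f k ≡ false
  off-i k k≢i = cong (_∧ f k) (dec-false (k ≟ i) k≢i)

odd : ℕ → Bool
odd 0       = false
odd (suc n) = not (odd n)

odd⇔%2≡1 : ∀ n → (odd n ≡ true) ⇔ (n % 2 ≡ 1)
odd⇔%2≡1 0             = mk⇔ (λ ()) (λ ())
odd⇔%2≡1 1             = mk⇔ (λ _ → refl) (λ _ → refl)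
odd⇔%2≡1 (suc (suc n)) rewrite not-involutive (odd n) = odd⇔%2≡1 n

odd-length-filter : ∀ {X : Set} {P : X → Set} (P? : Decidable P) (L : List X) →
  odd (length (filter P? L)) ≡ sum₂ L (λ x → does (P? x))
odd-length-filter P? []      = refl
odd-length-filter P? (x ∷ L) with does (P? x)
... | false = odd-length-filter P? L
... | true  = cong not (odd-length-filter P? L)

does-⇔ : ∀ {P Q : Set} → (P → Q) → (Q → P) → (p? : Dec P) (q? : Dec Q) → does p? ≡ does q?
does-⇔ to from p? q? = does-≡ p? (map′ from to q?)

identity-does : ∀ {n} (i j : Fin n) → identity i j ≡ does (i ≟ j)
identity-does i j with i ≟ j
... | yes _ = refl
... | no  _ = refl

inverse-recurrence : ∀ {n} (A B : Matrix n) → UnitDiagonal A → (∀ i j → (A ⊗ B) i j ≡ identity i j) →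
  ∀ i j → B i j ≡ does (i ≟ j) xor Σ₂≢ i (λ k → A i k ∧ B k j)
inverse-recurrence A B unit AB i j = solve (begin
  B i j xor S                ≡⟨ cong (λ a → (a ∧ B i j) xor S) (sym (unit i)) ⟩
  (A i i ∧ B i j) xor S      ≡⟨ sym (Σ₂-split (λ k → A i k ∧ B k j) i) ⟩
  (A ⊗ B) i j                ≡⟨ AB i j ⟩
  identity i j               ≡⟨ identity-does i j ⟩
  does (i ≟ j)               ∎)
  where
  S : Bool
  S = Σ₂≢ i (λ k → A i k ∧ B k j)
  solve : ∀ {b d} → b xor S ≡ d → b ≡ d xor S
  solve {b} refl = sym (begin
    (b xor S) xor S ≡⟨ xor-assoc b S S ⟩
    b xor (S xor S) ≡⟨ cong (b xor_) (xor-same S) ⟩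
    b xor false     ≡⟨ xor-identityʳ b ⟩
    b               ∎)

sum₂-listsUpTo-suc : ∀ {n} m (p : List (Fin n) → Bool) →
  sum₂ (listsUpTo (suc m)) p ≡ p [] xor Σ₂ (λ k → sum₂ (listsUpTo m) (λ ks → p (k ∷ ks)))
sum₂-listsUpTo-suc {n} m p = cong (p [] xor_) (trans
  (sum₂-concatMap (λ k → map (k ∷_) (listsUpTo m)) (allFin n) p)
  (sum₂-cong (allFin n) (λ k → sum₂-map (k ∷_) (listsUpTo m) p)))

module Paths {n : ℕ} (A : Matrix n) (lower : LowerTriangular A) where

  edge-descends : ∀ {k l} → Edge A k l → l ≢ k → toℕ l < toℕ k
  edge-descends {k} {l} edge l≢k = ≤∧≢⇒< (≮⇒≥ no-ascent) (l≢k ∘ toℕ-injective)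
    where
    no-ascent : toℕ k ≮ toℕ l
    no-ascent k<l with () ← trans (sym edge) (lower k l k<l)

  path-bounded : ∀ k ks → Linked (Edge A) (k ∷ ks) → Unique (k ∷ ks) → All (λ x → toℕ x ≤ toℕ k) (k ∷ ks)
  path-bounded k []       _           _                  = ≤-refl ∷ []
  path-bounded k (l ∷ ks) (edge ∷ lk) ((k≢l ∷ _) ∷ uniq) =
    ≤-refl ∷ All.map (λ x≤l → ≤-trans x≤l (<⇒≤ l<k)) (path-bounded l ks lk uniq)
    where
    l<k : toℕ l < toℕ k
    l<k = edge-descends edge (k≢l ∘ sym)

  isAlt : Fin n → Fin n → List (Fin n) → Bool
  isAlt i j ks = does (altPath? A i j ks)

  isAlt-[] : ∀ i j → isAlt i j [] ≡ false
  isAlt-[] i j = dec-false (altPath? A i j []) (λ { (() , _) })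

  isAlt-start : ∀ i j k ks → k ≢ i → isAlt i j (k ∷ ks) ≡ false
  isAlt-start i j k ks k≢i = dec-false (altPath? A i j (k ∷ ks)) (λ { (k≡i , _) → k≢i (just-injective k≡i) })

  isAlt-single : ∀ i j → isAlt i j (i ∷ []) ≡ does (i ≟ j)
  isAlt-single i j = does-⇔ (λ { (_ , i≡j , _) → just-injective i≡j })
                            (λ i≡j → refl , cong just i≡j , ([] ∷ []) , [-])
                            (altPath? A i j (i ∷ [])) (i ≟ j)

  isAlt-step : ∀ i j k ks → isAlt i j (i ∷ k ∷ ks) ≡ not (does (k ≟ i)) ∧ (A i k ∧ isAlt k j (k ∷ ks))
  isAlt-step i j k ks with k ≟ i
  ... | yes refl =
    dec-false (altPath? A i j (i ∷ i ∷ ks)) (λ { (_ , _ , ((i≢i ∷ _) ∷ _) , _) → i≢i refl })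
  ... | no k≢i   = after-edge (A i k) refl
    where
    -- vertices after C_k have index ≤ k < i, so the path does not revisit i
    fresh : Edge A i k → Linked (Edge A) (k ∷ ks) → Unique (k ∷ ks) → All (i ≢_) (k ∷ ks)
    fresh edge lk uniq =
      All.map (λ { x≤k refl → <⇒≱ (edge-descends edge k≢i) x≤k }) (path-bounded k ks lk uniq)
    after-edge : ∀ b → A i k ≡ b → isAlt i j (i ∷ k ∷ ks) ≡ b ∧ isAlt k j (k ∷ ks)
    after-edge false aik =
      dec-false (altPath? A i j (i ∷ k ∷ ks)) (λ { (_ , _ , _ , (edge ∷ _)) → no-edge (trans (sym edge) aik) })
      where
      no-edge : ¬ (true ≡ false)
      no-edge ()
    after-edge true  aik =
      does-⇔ (λ { (_ , end , (_ ∷ uniq) , (_ ∷ lk)) → refl , end , uniq , lk })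
             (λ { (_ , end , uniq , lk) → refl , end , (fresh aik lk uniq ∷ uniq) , (aik ∷ lk) })
             (altPath? A i j (i ∷ k ∷ ks)) (altPath? A k j (k ∷ ks))

  lowerRow-cong : ∀ i {f g : Fin n → Bool} → (∀ k → toℕ k < toℕ i → f k ≡ g k) →
    Σ₂≢ i (λ k → A i k ∧ f k) ≡ Σ₂≢ i (λ k → A i k ∧ g k)
  lowerRow-cong i {f} {g} f≡g = sum₂-cong (allFin n) term
    where
    when-edge : ∀ b {x y} → (b ≡ true → x ≡ y) → b ∧ x ≡ b ∧ y
    when-edge false _   = refl
    when-edge true  x≡y = x≡y refl
    term : ∀ k → not (does (k ≟ i)) ∧ (A i k ∧ f k) ≡ not (does (k ≟ i)) ∧ (A i k ∧ g k)
    term k with k ≟ i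
    ... | yes _   = refl
    ... | no k≢i  = when-edge (A i k) (λ edge → f≡g k (edge-descends edge k≢i))

  -- parity of the alternating paths from C_i to R_j with at most m+1 matching edges
  pathParity : ℕ → Fin n → Fin n → Bool
  pathParity m i j = sum₂ (listsUpTo m) (λ ks → isAlt i j (i ∷ ks))

  pathParity-zero : ∀ i j → pathParity 0 i j ≡ does (i ≟ j)
  pathParity-zero i j = trans (xor-identityʳ _) (isAlt-single i j)

  pathParity-suc : ∀ m i j → pathParity (suc m) i j ≡ does (i ≟ j) xor Σ₂≢ i (λ k → A i k ∧ pathParity m k j)
  pathParity-suc m i j = trans (sum₂-listsUpTo-suc m (λ ks → isAlt i j (i ∷ ks)))
                               (cong₂ _xor_ (isAlt-single i j) (sum₂-cong (allFin n) first-step))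
    where
    L : List (List (Fin n))
    L = listsUpTo m
    first-step : ∀ k → sum₂ L (λ ks → isAlt i j (i ∷ k ∷ ks)) ≡ not (does (k ≟ i)) ∧ (A i k ∧ pathParity m k j)
    first-step k = begin
      sum₂ L (λ ks → isAlt i j (i ∷ k ∷ ks))                                 ≡⟨ sum₂-cong L (isAlt-step i j k) ⟩
      sum₂ L (λ ks → not (does (k ≟ i)) ∧ (A i k ∧ isAlt k j (k ∷ ks)))      ≡⟨ sum₂-∧ L _ _ ⟩
      not (does (k ≟ i)) ∧ sum₂ L (λ ks → A i k ∧ isAlt k j (k ∷ ks))        ≡⟨ cong (not (does (k ≟ i)) ∧_) (sum₂-∧ L _ _) ⟩
      not (does (k ≟ i)) ∧ (A i k ∧ pathParity m k j)                        ∎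

  -- every path from C_i starts with index i, so the lists k ∷ ks with k ≠ i do not count
  allPaths-parity : ∀ m i j → sum₂ (listsUpTo (suc m)) (isAlt i j) ≡ pathParity m i j
  allPaths-parity m i j = begin
    sum₂ (listsUpTo (suc m)) (isAlt i j)                          ≡⟨ sum₂-listsUpTo-suc m (isAlt i j) ⟩
    isAlt i j [] xor Σ₂ (λ k → sum₂ L (λ ks → isAlt i j (k ∷ ks))) ≡⟨ cong (_xor Σ₂ (λ k → sum₂ L (λ ks → isAlt i j (k ∷ ks)))) (isAlt-[] i j) ⟩
    Σ₂ (λ k → sum₂ L (λ ks → isAlt i j (k ∷ ks)))                 ≡⟨ Σ₂-single _ i off-i ⟩
    pathParity m i j                                              ∎
    where
    L : List (List (Fin n))
    L = listsUpTo m
    off-i : ∀ k → k ≢ i → sum₂ L (λ ks → isAlt i j (k ∷ ks)) ≡ false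
    off-i k k≢i = sum₂-zero L (λ ks → isAlt-start i j k ks k≢i)

  pathParity≡ : ∀ (B : Matrix n) → (∀ i j → B i j ≡ does (i ≟ j) xor Σ₂≢ i (λ k → A i k ∧ B k j)) →
    ∀ m i j → toℕ i ≤ m → pathParity m i j ≡ B i j
  pathParity≡ B rec 0       i j i≤0   = begin
    pathParity 0 i j                                  ≡⟨ pathParity-zero i j ⟩
    does (i ≟ j)                                      ≡⟨ sym (xor-identityʳ _) ⟩
    does (i ≟ j) xor false                            ≡⟨ cong (does (i ≟ j) xor_) (sym (sum₂-zero (allFin n) vanish)) ⟩
    does (i ≟ j) xor Σ₂≢ i (λ k → A i k ∧ false)      ≡⟨ cong (does (i ≟ j) xor_) (lowerRow-cong i none-below) ⟩
    does (i ≟ j) xor Σ₂≢ i (λ k → A i k ∧ B k j)      ≡⟨ sym (rec i j) ⟩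
    B i j                                             ∎
    where
    vanish : ∀ k → not (does (k ≟ i)) ∧ (A i k ∧ false) ≡ false
    vanish k = trans (cong (not (does (k ≟ i)) ∧_) (∧-zeroʳ (A i k))) (∧-zeroʳ _)
    none-below : ∀ k → toℕ k < toℕ i → false ≡ B k j
    none-below k k<i = ⊥-elim (n≮0 (<-≤-trans k<i i≤0))
  pathParity≡ B rec (suc m) i j i≤1+m = begin
    pathParity (suc m) i j                                ≡⟨ pathParity-suc m i j ⟩
    does (i ≟ j) xor Σ₂≢ i (λ k → A i k ∧ pathParity m k j) ≡⟨ cong (does (i ≟ j) xor_) (lowerRow-cong i below) ⟩
    does (i ≟ j) xor Σ₂≢ i (λ k → A i k ∧ B k j)          ≡⟨ sym (rec i j) ⟩
    B i j                                                 ∎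
    where
    below : ∀ k → toℕ k < toℕ i → pathParity m k j ≡ B k j
    below k k<i = pathParity≡ B rec m k j (≤-pred (<-≤-trans k<i i≤1+m))

corollary2p2 : (n : ℕ) (A B : Matrix n) → LowerTriangular A → UnitDiagonal A
    → IsInverse A B
    → ∀ (i j : Fin n) → toℕ j ≤ toℕ i
    → (B i j ≡ true) ⇔ (numAltPaths A i j % 2 ≡ 1)
corollary2p2 (suc n) A B lower unit (AB , _) i j _ =
  subst (λ b → (b ≡ true) ⇔ (N % 2 ≡ 1)) parity≡b (odd⇔%2≡1 N)
  where
  open Paths A lower
  N : ℕ
  N = numAltPaths A i j
  parity≡b : odd N ≡ B i j
  parity≡b = begin
    odd N                                   ≡⟨ odd-length-filter (altPath? A i j) (listsUpTo (suc n)) ⟩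
    sum₂ (listsUpTo (suc n)) (isAlt i j)    ≡⟨ allPaths-parity n i j ⟩
    pathParity n i j                        ≡⟨ pathParity≡ B (inverse-recurrence A B unit AB) n i j (≤-pred (toℕ<n i)) ⟩
    B i j                                   ∎
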